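{- Let $G=(V,A)$ be a flow graph with start vertex $s$, let $F$ be a depth-first spanning tree of $G$ rooted at $s$ with vertices identified with their preorder numbers. Let $v\neq s$ be a vertex with $g(v)>v$, and let $a$ be the nearest common ancestor of $v$ and $g(v)$ in $F$. Then there is a vertex $w$ on $F(a,g(v)]$ such that $\mathit{sd}(w)=\mathit{sd}(v)$.
   Context: A flow graph is a finite directed graph $G=(V,A)$ with start vertex $s$ such that every vertex is reachable from $s$; there are no arcs entering $s$. $F$ is the spanning tree produced by a depth-first search of $G$ from $s$, vertices numbered $1,\dots,n$ in the order first visited. A path from $u$ to $v$ is high if all its vertices other than $u$ and $v$ are greater than both $u$ and $v$. For $v\neq s$, $\mathit{sd}(v)$ (the semi-dominator) is the minimum vertex $u$ such that there is a high path from $u$ to $v$, and $(g(v),v)\in A$ is an arc that is the last arc on some high path from $\mathit{sd}(v)$ to $v$. For a proper ancestor $a$ of $x$ in $F$, $F(a,x]$ denotes the path in $F$ from the child of $a$ that is an ancestor of $x$ down to $x$. -}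

module Defs where

open import Data.Nat using (ℕ; zero; suc; _<_; _≤_)
open import Data.Product using (Σ; _×_; _,_)
open import Data.List using (List; []; _∷_)
open import Data.List.Relation.Unary.All using (All)
open import Data.List.Membership.Propositional using (_∈_)
open import Relation.Binary.PropositionalEquality using (_≡_; _≢_)

-- Vertices are natural numbers (their DFS preorder numbers) 0 … n-1;
-- the start vertex s is 0.  Arcs are a finite list of pairs.
Arcs : Set
Arcs = List (ℕ × ℕ)

data Anc (par : ℕ → ℕ) (u : ℕ) : ℕ → Set where
  here : Anc par u u
  step : ∀ {v} → 0 < v → Anc par u (par v) → Anc par u v

PAnc : (ℕ → ℕ) → ℕ → ℕ → Set
PAnc par u v = Anc par u v × u ≢ v

-- DFS trees with preorder numbering are characterised by:
-- parent numbers are smaller, every subtree is an interval of numbers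
-- starting at its root (preorder), and every arc (u,v) with u < v goes from
-- an ancestor to a descendant (no cross/forward-to-the-right arcs).
record DFSFlowGraph (n : ℕ) : Set where
  field
    arcs       : Arcs
    arcs-bound : ∀ {u v} → (u , v) ∈ arcs → u < n × v < n
    no-entry-s : ∀ {u v} → (u , v) ∈ arcs → v ≢ 0
    par        : ℕ → ℕ
    par-lt     : ∀ v → 0 < v → v < n → par v < v
    tree-arc   : ∀ v → 0 < v → v < n → (par v , v) ∈ arcs
    preorder   : ∀ {u v w} → Anc par u v → v < n → u ≤ w → w ≤ v → Anc par u w
    dfs-arcs   : ∀ {u v} → (u , v) ∈ arcs → u < v → Anc par u v

Chain : Arcs → ℕ → List ℕ → ℕ → Set
Chain A u []       v = (u , v) ∈ A
Chain A u (x ∷ xs) v = (u , x) ∈ A × Chain A x xs v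

lastBefore : ℕ → List ℕ → ℕ
lastBefore u []       = u
lastBefore u (x ∷ xs) = lastBefore x xs

HighPathVia : Arcs → ℕ → ℕ → ℕ → Set
HighPathVia A u x v =
  Σ (List ℕ) λ xs → Chain A u xs v × All (λ y → u < y × v < y) xs × lastBefore u xs ≡ x

HighPath : Arcs → ℕ → ℕ → Set
HighPath A u v = Σ (List ℕ) λ xs → Chain A u xs v × All (λ y → u < y × v < y) xs

IsSd : Arcs → ℕ → ℕ → Set
IsSd A v u = HighPath A u v × (∀ u' → HighPath A u' v → u ≤ u')

IsG : Arcs → ℕ → ℕ → Set
IsG A v x = Σ ℕ λ sdv → IsSd A v sdv × HighPathVia A sdv x v

IsNCA : (ℕ → ℕ) → ℕ → ℕ → ℕ → Set
IsNCA par a u v = Anc par a u × Anc par a v × (∀ c → Anc par c u → Anc par c v → Anc par c a)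

module Submission where

-- Take a high path  sd(v) = x₀ → x₁ → … → xₖ → v  whose last
-- arc is (g(v), v).  Its interior is nonempty, since sd(v) < v < g(v), and we
-- let w be the first occurrence of the minimum interior vertex.  Then
--   * sd(w) = sd(v): the prefix up to w is a high path from sd(v) to w, and any
--     high path from some u < w to w extends by the suffix after w to a high
--     path from u to v, so u ≥ sd(v);
--   * w is an ancestor of g(v): the suffix after w only visits vertices ≥ w,
--     and in a DFS tree such a walk can never leave the subtree of w;
--   * w lies strictly below the nearest common ancestor a: otherwise the
--     preorder property makes w an ancestor of a, hence of v, so w ≤ v,
--     contradicting v < w.

open import Defs
open import Data.Nat using (ℕ; _<_; _≤_)
open import Data.Nat.Properties
open import Data.Product using (Σ; _×_; _,_; proj₁; proj₂)
open import Data.List using (List; []; _∷_; _++_)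
open import Data.List.Relation.Unary.All as All using (All; []; _∷_)
open import Data.List.Relation.Unary.All.Properties using (++⁺; ++⁻)
open import Data.List.Membership.Propositional using (_∈_)
open import Relation.Binary.PropositionalEquality using (_≡_; _≢_; refl; sym; trans; subst; cong)
open import Relation.Nullary using (yes; no)
open import Data.Empty using (⊥-elim)

anc-trans : ∀ {par u w v} → Anc par u w → Anc par w v → Anc par u v
anc-trans u≼w here         = u≼w
anc-trans u≼w (step 0<v p) = step 0<v (anc-trans u≼w p)

lastBefore-++ : ∀ u m pre post → lastBefore u (pre ++ m ∷ post) ≡ lastBefore m post
lastBefore-++ u m []        post = refl
lastBefore-++ u m (x ∷ pre) post = lastBefore-++ x m pre post

module Paths {A : Arcs} where

  chain-++ : ∀ {u m y} pre post →
    Chain A u pre m → Chain A m post y → Chain A u (pre ++ m ∷ post) y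
  chain-++ []        post u→m        m→y = u→m , m→y
  chain-++ (x ∷ pre) post (u→x , x→m) m→y = u→x , chain-++ pre post x→m m→y

  chain-split : ∀ {u m y} pre post →
    Chain A u (pre ++ m ∷ post) y → Chain A u pre m × Chain A m post y
  chain-split []        post (u→m , m→y) = u→m , m→y
  chain-split (x ∷ pre) post (u→x , rest) =
    let x→m , m→y = chain-split pre post rest in (u→x , x→m) , m→y

  chain-lastArc : ∀ {x y} xs → Chain A x xs y → (lastBefore x xs , y) ∈ A
  chain-lastArc []       x→y        = x→y
  chain-lastArc (z ∷ zs) (_ , rest) = chain-lastArc zs rest

  sd-unique : ∀ {v s s'} → IsSd A v s → IsSd A v s' → s ≡ s'
  sd-unique (hp , min) (hp' , min') = ≤-antisym (min _ hp') (min' _ hp)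

record FirstMin (xs : List ℕ) : Set where
  field
    pre post   : List ℕ
    m          : ℕ
    split-eq   : xs ≡ pre ++ m ∷ post
    pre-above  : All (m <_) pre
    post-above : All (m ≤_) post

firstMin : ∀ x xs → FirstMin (x ∷ xs)
firstMin x [] = record
  { pre = [] ; post = [] ; m = x ; split-eq = refl ; pre-above = [] ; post-above = [] }
firstMin x (y ∷ ys) with firstMin y ys
... | r with FirstMin.m r <? x
...   | yes m<x = record
  { pre = x ∷ pre ; post = post ; m = m ; split-eq = cong (x ∷_) split-eq
  ; pre-above = m<x ∷ pre-above ; post-above = post-above }
  where open FirstMin r
...   | no m≮x = record
  { pre = [] ; post = y ∷ ys ; m = x ; split-eq = refl ; pre-above = []
  ; post-above = subst (All (x ≤_)) (sym split-eq)
      (All.map (≤-trans (≮⇒≥ m≮x))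
        (++⁺ (All.map <⇒≤ pre-above) (≤-refl ∷ post-above))) }
  where open FirstMin r

record MinSplit (A : Arcs) (s g v : ℕ) : Set where
  field
    m          : ℕ
    pre post   : List ℕ
    to-m       : Chain A s pre m
    from-m     : Chain A m post v
    pre-high   : All (λ y → s < y × m < y) pre
    post-above : All (λ y → m ≤ y × v < y) post
    s<m        : s < m
    v<m        : v < m
    last-arc   : lastBefore m post ≡ g

minSplit : ∀ {A s g v} → HighPathVia A s g v → s ≢ g → MinSplit A s g v
minSplit         ([] , _ , _ , s≡g) s≢g = ⊥-elim (s≢g s≡g)
minSplit {A} {s} {v = v} (x ∷ xs , path , high , last≡g) _ = record
  { m = m ; pre = pre ; post = post ; to-m = to-m ; from-m = from-m
  ; pre-high   = All.zipWith (λ ((s<y , _) , m<y) → s<y , m<y) (high-pre , pre-above)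
  ; post-above = All.zipWith (λ (m≤y , (_ , v<y)) → m≤y , v<y) (post-above , high-post)
  ; s<m = s<m ; v<m = v<m
  ; last-arc = trans (sym (lastBefore-++ s m pre post))
                     (trans (cong (lastBefore s) (sym split-eq)) last≡g) }
  where
  open FirstMin (firstMin x xs)
  path′ : Chain A s (pre ++ m ∷ post) v
  path′ = subst (λ zs → Chain A s zs v) split-eq path
  to-m : Chain A s pre m
  to-m = proj₁ (Paths.chain-split pre post path′)
  from-m : Chain A m post v
  from-m = proj₂ (Paths.chain-split pre post path′)
  High : ℕ → Set
  High y = s < y × v < y
  high′ : All High pre × All High (m ∷ post)
  high′ = ++⁻ pre (subst (All High) split-eq high)
  high-pre : All High pre
  high-pre = proj₁ high′
  s<m : s < m
  s<m = proj₁ (All.head (proj₂ high′))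
  v<m : v < m
  v<m = proj₂ (All.head (proj₂ high′))
  high-post : All High post
  high-post = All.tail (proj₂ high′)

-- The first minimum m on a high path from sd(v) to v has sd(m) = sd(v):
-- a high path from u < m to m continues along the suffix to a high path to v.
sd-at-minimum : ∀ {A s g v} → IsSd A v s → (r : MinSplit A s g v) → IsSd A (MinSplit.m r) s
sd-at-minimum {A} {s} (_ , sd-min) r =
  (pre , to-m , pre-high) , minimal
  where
  open MinSplit r
  minimal : ∀ u → HighPath A u m → s ≤ u
  minimal u (ys , u→m , ys-high) with u <? m
  ... | no u≮m  = <⇒≤ (<-≤-trans s<m (≮⇒≥ u≮m))
  ... | yes u<m = sd-min u
    ( ys ++ m ∷ post
    , Paths.chain-++ ys post u→m from-m
    , ++⁺ (All.map (λ (u<y , m<y) → u<y , <-trans v<m m<y) ys-high)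
          ((u<m , v<m) ∷ All.map (λ (m≤y , v<y) → <-≤-trans u<m m≤y , v<y) post-above) )

module DFS {n} (G : DFSFlowGraph n) where
  open DFSFlowGraph G

  anc⇒≤ : ∀ {u v} → Anc par u v → v < n → u ≤ v
  anc⇒≤ here _ = ≤-refl
  anc⇒≤ {v = v} (step 0<v u≼pv) v<n =
    <⇒≤ (≤-<-trans (anc⇒≤ u≼pv (<-trans pv<v v<n)) pv<v)
    where pv<v = par-lt v 0<v v<n

  -- The semi-dominator of a non-root vertex is smaller than it, because the
  -- tree arc from its parent is already a high path.
  sd<v : ∀ {v s} → IsSd arcs v s → 0 < v → v < n → s < v
  sd<v {v} (_ , sd-min) 0<v v<n =
    ≤-<-trans (sd-min (par v) ([] , tree-arc v 0<v v<n , [])) (par-lt v 0<v v<n)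

  -- A path that starts in the subtree of u and never visits a vertex smaller
  -- than u stays in that subtree (up to its last interior vertex): upward
  -- arcs are tree descents, and other arcs are caught by the preorder interval.
  stays-in-subtree : ∀ {u x y} xs → Anc par u x → Chain arcs x xs y → All (u ≤_) xs →
    Anc par u (lastBefore x xs)
  stays-in-subtree []       u≼x _          _ = u≼x
  stays-in-subtree {x = x} (z ∷ zs) u≼x (x→z , rest) (u≤z ∷ u≤zs) with x <? z
  ... | yes x<z = stays-in-subtree zs (anc-trans u≼x (dfs-arcs x→z x<z)) rest u≤zs
  ... | no x≮z  = stays-in-subtree zs
                    (preorder u≼x (proj₁ (arcs-bound x→z)) u≤z (≮⇒≥ x≮z)) rest u≤zs

  -- An ancestor m of g which is larger than v lies strictly below every
  -- common ancestor a of v and g: if m ≤ a, the preorder property would make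
  -- m an ancestor of a and hence of v.
  below-common-ancestor : ∀ {a v g m} → Anc par a v → Anc par a g → Anc par m g →
    v < n → g < n → v < m → PAnc par a m
  below-common-ancestor {a} {m = m} a≼v a≼g m≼g v<n g<n v<m with m ≤? a
  ... | yes m≤a = ⊥-elim (<⇒≱ v<m
          (anc⇒≤ (anc-trans (preorder m≼g g<n m≤a (anc⇒≤ a≼g g<n)) a≼v) v<n))
  ... | no m≰a  = preorder a≼g g<n (<⇒≤ a<m) (anc⇒≤ m≼g g<n) , <⇒≢ a<m
    where a<m = ≰⇒> m≰a

lemma33 : ∀ {n} (G : DFSFlowGraph n) (v gv sdv a : ℕ) →
    0 < v → v < n →
    IsSd (DFSFlowGraph.arcs G) v sdv →
    IsG (DFSFlowGraph.arcs G) v gv →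
    v < gv →
    IsNCA (DFSFlowGraph.par G) a v gv →
    Σ ℕ λ w → PAnc (DFSFlowGraph.par G) a w × Anc (DFSFlowGraph.par G) w gv
    × IsSd (DFSFlowGraph.arcs G) w sdv
lemma33 {n} G v gv sdv a 0<v v<n sdv-is-sd (s , s-is-sd , via) v<gv (a≼v , a≼gv , _)
  with Paths.sd-unique s-is-sd sdv-is-sd
... | refl = m , below-common-ancestor a≼v a≼gv m≼gv v<n gv<n v<m , m≼gv
           , sd-at-minimum sdv-is-sd r
  where
  open DFSFlowGraph G
  open DFS G
  sdv<gv : sdv < gv
  sdv<gv = <-trans (sd<v sdv-is-sd 0<v v<n) v<gv
  r : MinSplit arcs sdv gv v
  r = minSplit via (<⇒≢ sdv<gv)
  open MinSplit r
  m≼gv : Anc par m gv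
  m≼gv = subst (Anc par m) last-arc
           (stays-in-subtree post here from-m (All.map proj₁ post-above))
  gv<n : gv < n
  gv<n = proj₁ (arcs-bound (subst (λ x → (x , v) ∈ arcs) last-arc
           (Paths.chain-lastArc post from-m)))
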